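{- For every integer $n\geq 3$, there exists a graph $G$ of order $n$ with $\chi_d^{tt}(G)=n$.
   Context: All graphs are finite, simple and undirected. For a graph $G=(V,E)$ call the elements of $V\cup E$ objects; two vertices are adjacent if joined by an edge, two edges are adjacent if they share an endpoint, and a vertex and an edge are incident if the vertex is an endpoint of the edge. A total coloring of $G$ assigns a color to every object so that any two adjacent or incident objects receive different colors; a color class is the set of all objects of one color. A total dominator total coloring of a graph $G$ with positive minimum degree is a total coloring of $G$ in which every object of $G$ is adjacent or incident to every object of some color class. The total dominator total chromatic number $\chi_d^{tt}(G)$ is the minimum number of color classes in a total dominator total coloring of $G$. -}

module Defs where

open import Data.Nat using (ℕ; _<_)
open import Data.Fin using (Fin) renaming (_<_ to _<ᶠ_)
open import Data.Bool using (Bool; true; false)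
open import Data.Product using (Σ; ∃; _×_; _,_)
open import Data.Sum using (_⊎_; inj₁; inj₂)
open import Relation.Binary.PropositionalEquality using (_≡_; _≢_)
open import Relation.Nullary using (¬_)

record Graph (n : ℕ) : Set where
  field
    adj    : Fin n → Fin n → Bool
    adj-sym    : ∀ i j → adj i j ≡ adj j i
    adj-irrefl : ∀ i → adj i i ≡ false
open Graph public

-- Edges: unordered pairs {i,j} represented uniquely by i < j with i ~ j.
Edge : ∀ {n} → Graph n → Set
Edge {n} G = Σ (Fin n × Fin n) λ { (i , j) → (i <ᶠ j) × (adj G i j ≡ true) }

Obj : ∀ {n} → Graph n → Set
Obj {n} G = Fin n ⊎ Edge G

AdjInc : ∀ {n} (G : Graph n) → Obj G → Obj G → Set
AdjInc G (inj₁ u) (inj₁ v) = adj G u v ≡ true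
AdjInc G (inj₁ u) (inj₂ ((i , j) , _)) = (u ≡ i) ⊎ (u ≡ j)
AdjInc G (inj₂ ((i , j) , _)) (inj₁ u) = (u ≡ i) ⊎ (u ≡ j)
AdjInc G (inj₂ ((i , j) , _)) (inj₂ ((k , l) , _)) =
  ((i , j) ≢ (k , l)) × ((i ≡ k) ⊎ (i ≡ l) ⊎ (j ≡ k) ⊎ (j ≡ l))

PosMinDeg : ∀ {n} → Graph n → Set
PosMinDeg {n} G = ∀ (v : Fin n) → ∃ λ (u : Fin n) → adj G v u ≡ true

-- A total dominator total coloring with exactly k color classes:
-- c : Obj G → Fin k is surjective (so there are exactly k nonempty color
-- classes), a total coloring, and every object is adjacent or incident
-- to every object of some color class.
record IsTDTC {n} (G : Graph n) (k : ℕ) (c : Obj G → Fin k) : Set where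
  field
    proper    : ∀ x y → AdjInc G x y → c x ≢ c y
    onto      : ∀ (i : Fin k) → ∃ λ x → c x ≡ i
    dominates : ∀ x → ∃ λ (i : Fin k) → ∀ y → c y ≡ i → AdjInc G x y

HasTDTC : ∀ {n} → Graph n → ℕ → Set
HasTDTC G k = ∃ λ (c : Obj G → Fin k) → IsTDTC G k c

χdtt≡ : ∀ {n} → Graph n → ℕ → Set
χdtt≡ G m = HasTDTC G m × (∀ k → k < m → ¬ HasTDTC G k)

-- The star K₁,ₙ₋₁ works. Its centre together with its n − 1 edges are n
-- pairwise adjacent or incident objects, so every total colouring uses at
-- least n colours. Conversely, give the centre colour 0, each edge its own
-- colour, and each leaf the colour of some edge not at that leaf (possible
-- once there are two leaves): the centre dominates every other object, and
-- the centre itself dominates the colour class of any edge.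
module Submission where

open import Defs
open import Data.Nat as ℕ using (ℕ; _≥_; suc; z≤n; s≤s)
open import Data.Product using (∃; _×_; _,_; proj₂)
open import Data.Fin using (Fin; zero; suc)
open import Data.Fin.Properties using (pigeonhole; suc-injective; <⇒≢)
open import Data.Bool using (Bool; true; false)
open import Data.Sum using (inj₁; inj₂)
open import Data.Empty using (⊥-elim)
open import Function using (_∘_)
open import Relation.Binary.PropositionalEquality using (_≡_; _≢_; refl; sym; cong)
open import Relation.Nullary using (¬_)

IsTotalColouring : ∀ {n} (G : Graph n) {k} → (Obj G → Fin k) → Set
IsTotalColouring G c = ∀ x y → AdjInc G x y → c x ≢ c y

IsTotalClique : ∀ {n} (G : Graph n) {m} → (Fin m → Obj G) → Set
IsTotalClique G f = ∀ i j → i ≢ j → AdjInc G (f i) (f j)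

totalClique⇒¬totalColouring : ∀ {n} {G : Graph n} {m k} {f : Fin m → Obj G} →
  IsTotalClique G f → k ℕ.< m → (c : Obj G → Fin k) → ¬ IsTotalColouring G c
totalClique⇒¬totalColouring {f = f} clique k<m c proper
  with i , j , i<j , cfi≡cfj ← pigeonhole k<m (λ i → c (f i))
  = proper (f i) (f j) (clique i j (<⇒≢ i<j)) cfi≡cfj

totalClique⇒¬HasTDTC : ∀ {n} {G : Graph n} {m k} {f : Fin m → Obj G} →
  IsTotalClique G f → k ℕ.< m → ¬ HasTDTC G k
totalClique⇒¬HasTDTC clique k<m (c , tdtc) =
  totalClique⇒¬totalColouring clique k<m c (IsTDTC.proper tdtc)

module Star (k : ℕ) where

  starAdj : Fin (suc k) → Fin (suc k) → Bool
  starAdj zero    zero    = false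
  starAdj zero    (suc _) = true
  starAdj (suc _) zero    = true
  starAdj (suc _) (suc _) = false

  starAdj-sym : ∀ i j → starAdj i j ≡ starAdj j i
  starAdj-sym zero    zero    = refl
  starAdj-sym zero    (suc _) = refl
  starAdj-sym (suc _) zero    = refl
  starAdj-sym (suc _) (suc _) = refl

  starAdj-irrefl : ∀ i → starAdj i i ≡ false
  starAdj-irrefl zero    = refl
  starAdj-irrefl (suc _) = refl

  star : Graph (suc k)
  star = record { adj = starAdj ; adj-sym = starAdj-sym ; adj-irrefl = starAdj-irrefl }

  centre : Obj star
  centre = inj₁ zero

  spoke : Fin k → Edge star
  spoke l = (zero , suc l) , s≤s z≤n , refl

  data IsSpoke : Edge star → Set where
    isSpoke : ∀ l → IsSpoke (spoke l)

  edge-isSpoke : ∀ e → IsSpoke e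
  edge-isSpoke ((zero , suc l) , s≤s z≤n , refl) = isSpoke l
  edge-isSpoke ((suc _ , suc _) , _ , ())

  centre-incident : ∀ x → x ≢ centre → AdjInc star x centre
  centre-incident (inj₁ zero)    x≢centre = ⊥-elim (x≢centre refl)
  centre-incident (inj₁ (suc _)) _        = refl
  centre-incident (inj₂ e) _ with edge-isSpoke e
  ... | isSpoke l = inj₁ refl

  centre-dominates : ∀ y → y ≢ centre → AdjInc star centre y
  centre-dominates (inj₁ zero)    y≢centre = ⊥-elim (y≢centre refl)
  centre-dominates (inj₁ (suc _)) _        = refl
  centre-dominates (inj₂ e) _ with edge-isSpoke e
  ... | isSpoke l = inj₁ refl

  centreAndSpokes : Fin (suc k) → Obj star
  centreAndSpokes zero    = centre
  centreAndSpokes (suc l) = inj₂ (spoke l)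

  centreAndSpokes-totalClique : IsTotalClique star centreAndSpokes
  centreAndSpokes-totalClique zero    zero     0≢0   = ⊥-elim (0≢0 refl)
  centreAndSpokes-totalClique zero    (suc _)  _     = inj₁ refl
  centreAndSpokes-totalClique (suc _) zero     _     = inj₁ refl
  centreAndSpokes-totalClique (suc l) (suc l′) l≢l′ =
    (λ eq → l≢l′ (cong suc (suc-injective (cong proj₂ eq)))) , inj₁ refl

  star-posMinDeg : 1 ℕ.≤ k → PosMinDeg star
  star-posMinDeg (s≤s _) zero    = suc zero , refl
  star-posMinDeg (s≤s _) (suc _) = zero , refl

module StarColouring (j : ℕ) where
  open Star (suc (suc j))

  otherLeaf : Fin (suc (suc j)) → Fin (suc (suc j))
  otherLeaf zero    = suc zero
  otherLeaf (suc _) = zero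

  otherLeaf-≢ : ∀ l → otherLeaf l ≢ l
  otherLeaf-≢ zero    ()
  otherLeaf-≢ (suc _) ()

  colour : Obj star → Fin (suc (suc (suc j)))
  colour (inj₁ zero)             = zero
  colour (inj₁ (suc l))          = suc (otherLeaf l)
  colour (inj₂ ((_ , leaf) , _)) = leaf

  colour-proper : IsTotalColouring star colour
  colour-proper (inj₁ zero)    (inj₁ zero)    ()
  colour-proper (inj₁ (suc _)) (inj₁ (suc _)) ()
  colour-proper (inj₁ zero)    (inj₁ (suc _)) _ ()
  colour-proper (inj₁ (suc _)) (inj₁ zero)    _ ()
  colour-proper (inj₁ u) (inj₂ e) u∈e with edge-isSpoke e
  colour-proper (inj₁ zero)    (inj₂ _) _           | isSpoke l = λ ()
  colour-proper (inj₁ (suc _)) (inj₂ _) (inj₂ refl) | isSpoke l =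
    otherLeaf-≢ l ∘ suc-injective
  colour-proper (inj₂ e) (inj₁ u) u∈e with edge-isSpoke e
  colour-proper (inj₂ _) (inj₁ zero)    _           | isSpoke l = λ ()
  colour-proper (inj₂ _) (inj₁ (suc _)) (inj₂ refl) | isSpoke l =
    λ eq → otherLeaf-≢ l (suc-injective (sym eq))
  colour-proper (inj₂ e) (inj₂ e′) (e≢e′ , _) with edge-isSpoke e | edge-isSpoke e′
  ... | isSpoke l | isSpoke l′ = λ eq → e≢e′ (cong (zero ,_) eq)

  colour-onto : ∀ i → ∃ λ x → colour x ≡ i
  colour-onto zero    = centre , refl
  colour-onto (suc l) = inj₂ (spoke l) , refl

  colour≡0⇒centre : ∀ y → colour y ≡ zero → y ≡ centre
  colour≡0⇒centre (inj₁ zero) _ = refl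
  colour≡0⇒centre (inj₂ e) c≡0 with edge-isSpoke e
  colour≡0⇒centre (inj₂ _) () | isSpoke l

  colour≡1⇒≢centre : ∀ y → colour y ≡ suc zero → y ≢ centre
  colour≡1⇒≢centre (inj₁ zero) () refl

  dominatedByCentre : ∀ x → x ≢ centre → ∀ y → colour y ≡ zero → AdjInc star x y
  dominatedByCentre x x≢centre y cy≡0 with colour≡0⇒centre y cy≡0
  ... | refl = centre-incident x x≢centre

  colour-dominates : ∀ x → ∃ λ i → ∀ y → colour y ≡ i → AdjInc star x y
  colour-dominates (inj₁ zero) =
    suc zero , λ y cy≡1 → centre-dominates y (colour≡1⇒≢centre y cy≡1)
  colour-dominates x@(inj₁ (suc _)) = zero , dominatedByCentre x λ ()
  colour-dominates x@(inj₂ _)       = zero , dominatedByCentre x λ ()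

  colour-isTDTC : IsTDTC star (suc (suc (suc j))) colour
  colour-isTDTC = record
    { proper = colour-proper ; onto = colour-onto ; dominates = colour-dominates }

theorem3p2 : ∀ (n : ℕ) → n ≥ 3 → ∃ λ (G : Graph n) → PosMinDeg G × χdtt≡ G n
theorem3p2 (suc (suc (suc j))) (s≤s (s≤s (s≤s _))) =
  star , star-posMinDeg (s≤s z≤n) , (colour , colour-isTDTC) ,
  λ _ k<n → totalClique⇒¬HasTDTC centreAndSpokes-totalClique k<n
  where
    open Star (suc (suc j))
    open StarColouring j
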